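{- Consider the algorithm TRIÈST-FD with integer parameter $M\ge6$ run on a fully-dynamic edge stream (described in the context), and let $t^*$ be the first $t\ge M+1$ such that $|E^{(t)}|=M+1$ ($t^*=+\infty$ if no such time step exists). For all $t<t^*$ we have: (1) $d_o^{(t)}=0$; (2) $\mathcal{S}=E^{(t)}$ at the end of time step $t$; and (3) $M^{(t)}=s^{(t)}$.
   Context: Fully-dynamic edge stream: at each time $t\ge1$ an element $(\bullet,(u,v))$ with $\bullet\in\{+,-\}$, $u\ne v$, arrives; $E^{(0)}=\emptyset$, $E^{(t)}=E^{(t-1)}\cup\{(u,v)\}$ if $\bullet=+$ and $E^{(t-1)}\setminus\{(u,v)\}$ if $\bullet=-$; every element has effect (only absent edges are inserted, only present edges deleted). $s^{(t)}=|E^{(t)}|$. TRIÈST-FD keeps an edge sample $\mathcal{S}$ (initially empty) and counters $d_i,d_o$ (initially $0$). On a deletion $(-,(u,v))$: if $(u,v)\in\mathcal{S}$, remove it from $\mathcal{S}$ and increment $d_i$; otherwise increment $d_o$. On an insertion $(+,(u,v))$: if $d_i+d_o=0$, then if $|\mathcal{S}|<M$ insert $(u,v)$ in $\mathcal{S}$, else with probability $M/s^{(t)}$ replace an edge chosen uniformly at random from $\mathcal{S}$ by $(u,v)$ (otherwise do nothing); if $d_i+d_o>0$, then with probability $d_i/(d_i+d_o)$ insert $(u,v)$ in $\mathcal{S}$ and decrement $d_i$, otherwise decrement $d_o$. (The algorithm also maintains triangle counters, irrelevant here.) $M^{(t)}=|\mathcal{S}|$ and $d_o^{(t)}$ is the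 value of $d_o$, at the end of time $t$. -}

module Defs where

open import Data.Nat using (ℕ; zero; suc; _+_; _≤_; _<_)
import Data.Nat.Properties as ℕP
open import Data.Product using (_×_; _,_; proj₁; proj₂)
open import Data.Product.Properties using (≡-dec)
open import Data.List using (List; []; _∷_; length; filter)
open import Data.List.Membership.Propositional using (_∈_; _∉_)
open import Relation.Nullary using (¬_; Dec; ¬?)

open import Relation.Binary.PropositionalEquality using (_≡_; _≢_)

-- Vertices are natural numbers.  An (undirected) edge {u,v}, u ≠ v, is
-- encoded canonically as the ordered pair (u , v) with u < v.
Edge : Set
Edge = ℕ × ℕ

_≟ₑ_ : (e f : Edge) → Dec (e ≡ f)
_≟ₑ_ = ≡-dec ℕP._≟_ ℕP._≟_

remove : Edge → List Edge → List Edge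
remove e = filter (λ f → ¬? (f ≟ₑ e))

data Elem : Set where
  ins : Edge → Elem
  del : Edge → Elem

edgeOf : Elem → Edge
edgeOf (ins e) = e
edgeOf (del e) = e

-- A fully-dynamic edge stream: the element arriving at time t+1 is σ t.
Stream : Set
Stream = ℕ → Elem

apply : Elem → List Edge → List Edge
apply (ins e) E = e ∷ E
apply (del e) E = remove e E

Eset : Stream → ℕ → List Edge
Eset σ zero    = []
Eset σ (suc t) = apply (σ t) (Eset σ t)

sz : Stream → ℕ → ℕ
sz σ t = length (Eset σ t)

HasEffect : Elem → List Edge → Set
HasEffect (ins e) E = e ∉ E
HasEffect (del e) E = e ∈ E

ValidStream : Stream → Set
ValidStream σ = (t : ℕ) → (proj₁ (edgeOf (σ t)) < proj₂ (edgeOf (σ t)))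
                          × HasEffect (σ t) (Eset σ t)

-- state of TRIÈST-FD (triangle counters omitted): sample S, d_i, d_o
record State : Set where
  constructor ⟨_,_,_⟩
  field
    sample : List Edge
    dᵢ     : ℕ
    dₒ     : ℕ
open State public

initState : State
initState = ⟨ [] , 0 , 0 ⟩

-- One step of TRIÈST-FD with parameter M, when the current edge-set size
-- (after the element) is s.  Random choices are modelled
-- nondeterministically: every outcome that has positive probability is a
-- constructor.
data Step (M s : ℕ) : Elem → State → State → Set where
  del-in  : ∀ {e S di dO} → e ∈ S →
            Step M s (del e) ⟨ S , di , dO ⟩ ⟨ remove e S , suc di , dO ⟩
  del-out : ∀ {e S di dO} → e ∉ S →
            Step M s (del e) ⟨ S , di , dO ⟩ ⟨ S , di , suc dO ⟩
  ins-add : ∀ {e S} → length S < M →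
            Step M s (ins e) ⟨ S , 0 , 0 ⟩ ⟨ e ∷ S , 0 , 0 ⟩
  ins-replace : ∀ {e f S} → M ≤ length S → f ∈ S →
            Step M s (ins e) ⟨ S , 0 , 0 ⟩ ⟨ e ∷ remove f S , 0 , 0 ⟩
  -- insertion, d_i + d_o = 0, |S| ≥ M, no replacement (prob. 1 - M/s > 0)
  ins-skip : ∀ {e S} → M ≤ length S → M < s →
            Step M s (ins e) ⟨ S , 0 , 0 ⟩ ⟨ S , 0 , 0 ⟩
  -- insertion, d_i + d_o > 0, inserted (prob. d_i/(d_i+d_o) > 0 iff d_i > 0)
  ins-comp-in : ∀ {e S di dO} →
            Step M s (ins e) ⟨ S , suc di , dO ⟩ ⟨ e ∷ S , di , dO ⟩
  -- insertion, d_i + d_o > 0, not inserted (prob. d_o/(d_i+d_o) > 0 iff d_o > 0)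
  ins-comp-out : ∀ {e S di dO} →
            Step M s (ins e) ⟨ S , di , suc dO ⟩ ⟨ S , di , dO ⟩

-- st is a possible run of TRIÈST-FD (parameter M) on σ:
-- st t is the state at the end of time t.
Run : ℕ → Stream → (ℕ → State) → Set
Run M σ st = (st 0 ≡ initState)
           × ((t : ℕ) → Step M (sz σ (suc t)) (σ t) (st t) (st (suc t)))

-- t < t*, where t* is the first t' ≥ M+1 with |E^{(t')}| = M+1
BeforeTStar : ℕ → Stream → ℕ → Set
BeforeTStar M σ t = (t' : ℕ) → M + 1 ≤ t' → t' ≤ t → sz σ t' ≢ M + 1

_≈ₛ_ : List Edge → List Edge → Set
A ≈ₛ B = (e : Edge) → (e ∈ A → e ∈ B) × (e ∈ B → e ∈ A)

module Submission where

-- The edge-set size s^(t) starts at 0 and grows by at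
--    most one per time step, so s^(t) ≤ t, and a size-sequence that never
--    equals M+1 at any time in [M+1, t] stays ≤ M up to t (to exceed M it
--    would have to pass through M+1, necessarily at a time ≥ M+1).
--  * A one-step invariant.  Call a state "in sync" with E when its sample is
--    E and d_o = 0.  If the state is in sync with E^(t), the arriving element
--    has effect and s^(t+1) ≤ M, then every possible step of the algorithm
--    leads to a state in sync with E^(t+1): deletions hit the sample, and
--    insertions either are added (|S| < M) or are replayed by d_i.

open import Defs
open import Data.Nat using (ℕ; zero; suc; _+_; _≤_; z≤n; s≤s)
open import Data.Nat.Properties
  using (≤-refl; ≤-trans; ≤-pred; m≤n⇒m≤1+n; m≤n⇒m<n∨m≡n; <⇒≱; +-comm)
open import Data.Product using (_×_; _,_; proj₂)
open import Data.List using (List; length)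
open import Data.List.Properties using (length-filter)
open import Data.Sum using (inj₁; inj₂)
open import Data.Empty using (⊥-elim)
open import Function using (id)
open import Relation.Nullary using (¬?)
open import Relation.Binary.PropositionalEquality using (_≡_; _≢_; refl; sym; trans; cong; subst)

AvoidsFrom : (ℕ → ℕ) → ℕ → ℕ → Set
AvoidsFrom f c t = (t' : ℕ) → c ≤ t' → t' ≤ t → f t' ≢ c

avoidsFrom-pred : ∀ {f c t} → AvoidsFrom f c (suc t) → AvoidsFrom f c t
avoidsFrom-pred avoids t' c≤t' t'≤t = avoids t' c≤t' (m≤n⇒m≤1+n t'≤t)

module UnitGrowth (f : ℕ → ℕ) (starts-at-0 : f 0 ≡ 0)
                  (unit-steps : ∀ t → f (suc t) ≤ suc (f t)) where

  bounded-by-time : ∀ t → f t ≤ t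
  bounded-by-time zero    = subst (_≤ 0) (sym starts-at-0) z≤n
  bounded-by-time (suc t) = ≤-trans (unit-steps t) (s≤s (bounded-by-time t))

  -- Discrete intermediate values: to exceed c, f must hit c + 1, and it can
  -- only do so at a time ≥ c + 1.  So avoiding c + 1 on [c + 1, t] keeps f ≤ c.
  stays-below : ∀ c t → AvoidsFrom f (c + 1) t → f t ≤ c
  stays-below c zero    _      = subst (_≤ c) (sym starts-at-0) z≤n
  stays-below c (suc t) avoids
    with m≤n⇒m<n∨m≡n (≤-trans (unit-steps t)
                        (s≤s (stays-below c t (avoidsFrom-pred avoids))))
  ... | inj₁ below = ≤-pred below
  ... | inj₂ hits  = ⊥-elim (avoids (suc t) late ≤-refl hits′)
    where
    hits′ : f (suc t) ≡ c + 1
    hits′ = trans hits (+-comm 1 c)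

    late : c + 1 ≤ suc t
    late = subst (_≤ suc t) hits′ (bounded-by-time (suc t))

length-apply : ∀ a E → length (apply a E) ≤ suc (length E)
length-apply (ins e) E = ≤-refl
length-apply (del e) E = m≤n⇒m≤1+n (length-filter (λ f → ¬? (f ≟ₑ e)) E)

sz≤M-before-t* : ∀ M σ t → BeforeTStar M σ t → sz σ t ≤ M
sz≤M-before-t* M σ = UnitGrowth.stays-below (sz σ) refl
                       (λ t → length-apply (σ t) (Eset σ t)) M

InSync : List Edge → State → Set
InSync E x = (sample x ≡ E) × (dₒ x ≡ 0)

-- A deletion of an edge
-- outside the sample contradicts the element having effect; replacement and
-- skipping need |S| ≥ M, i.e. more than M edges after insertion; a pending
-- d_o is excluded by the invariant itself.
step-preserves-sync : ∀ {M s a x y E} → Step M s a x y → InSync E x →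
                      HasEffect a E → length (apply a E) ≤ M →
                      InSync (apply a E) y
step-preserves-sync (del-in _)          (refl , refl) _       _     = refl , refl
step-preserves-sync (del-out e∉S)       (refl , refl) e∈E     _     = ⊥-elim (e∉S e∈E)
step-preserves-sync (ins-add _)         (refl , refl) _       _     = refl , refl
step-preserves-sync (ins-replace M≤ _)  (refl , refl) _       small = ⊥-elim (<⇒≱ small M≤)
step-preserves-sync (ins-skip M≤ _)     (refl , refl) _       small = ⊥-elim (<⇒≱ small M≤)
step-preserves-sync ins-comp-in         (refl , refl) _       _     = refl , refl
step-preserves-sync ins-comp-out        (refl , ())   _       _

in-sync-before-t* : ∀ M σ → ValidStream σ → (st : ℕ → State) → Run M σ st →
                    ∀ t → BeforeTStar M σ t → InSync (Eset σ t) (st t)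
in-sync-before-t* M σ _ st (start , _) zero _ rewrite start = refl , refl
in-sync-before-t* M σ valid st run@(_ , steps) (suc t) before =
  step-preserves-sync (steps t)
    (in-sync-before-t* M σ valid st run t (avoidsFrom-pred before))
    (proj₂ (valid t))
    (sz≤M-before-t* M σ (suc t) before)

≡⇒≈ₛ : ∀ {A B} → A ≡ B → A ≈ₛ B
≡⇒≈ₛ refl e = id , id

-- Lemma A.7.
lemmaA7 : (M : ℕ) → 6 ≤ M → (σ : Stream) → ValidStream σ →
          (st : ℕ → State) → Run M σ st →
          (t : ℕ) → BeforeTStar M σ t →
          (dₒ (st t) ≡ 0)
          × (sample (st t) ≈ₛ Eset σ t)
          × (length (sample (st t)) ≡ sz σ t)
lemmaA7 M _ σ valid st run t before =
  let (sample≡E , dₒ≡0) = in-sync-before-t* M σ valid st run t before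
  in dₒ≡0 , ≡⇒≈ₛ sample≡E , cong length sample≡E
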